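{- Let $k>1$ be an integer, let $a_1,\ldots,a_k\in\mathbb{Z}$ and $n_1,\ldots,n_k\in\mathbb{Z}^+$, and let $w:\mathbb{Z}\to\mathbb{Z}$ be the covering function $w(x)=|\{1\leqslant s\leqslant k:\ x\equiv a_s\ (\mathrm{mod}\ n_s)\}|$. Suppose that there exist $m\in\mathbb{Z}^+$ and $a\in\mathbb{Z}$ such that $w(x)\equiv a\ (\mathrm{mod}\ m)$ for all $x\in\mathbb{Z}$. Then, for any $t\in\{1,\ldots,k\}$ such that $mn_t$ does not divide $[n_1,\ldots,n_k]$ (the least common multiple of $n_1,\ldots,n_k$), there exists $s\in\{1,\ldots,k\}$ with $s\neq t$ and $n_t\mid n_s$.
   Context: For $a\in\mathbb{Z}$ and $n\in\mathbb{Z}^+$, $a(n)$ denotes the residue class $\{x\in\mathbb{Z}: x\equiv a\ (\mathrm{mod}\ n)\}$; the system under consideration is $\{a_s(n_s)\}_{s=1}^k$. -}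

module Defs where

open import Data.Nat using (ℕ)
open import Data.Nat.LCM using (lcm)
open import Data.Integer as ℤ using (ℤ; +_; _-_)
open import Data.Integer.Divisibility as ℤD using ()
open import Data.Fin using (Fin)
open import Data.List using (List; length; filter; foldr)
open import Data.List using (allFin) public

_≡_[mod_] : ℤ → ℤ → ℕ → Set
x ≡ y [mod n ] = (+ n) ℤD.∣ (x - y)

open import Relation.Nullary using (Dec)
import Data.Nat.Divisibility as ℕD

congDec : ∀ x y n → Dec (x ≡ y [mod n ])
congDec x y n = ℕD._∣?_ n (ℤ.∣ x - y ∣)

w : ∀ {k} → (Fin k → ℤ) → (Fin k → ℕ) → ℤ → ℕ
w {k} a n x = length (filter (λ s → congDec x (a s) (n s)) (allFin k))

lcmAll : ∀ {k} → (Fin k → ℕ) → ℕ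
lcmAll {k} n = foldr (λ s acc → lcm (n s) acc) 1 (allFin k)

{-# OPTIONS --safe #-}
-- Suppose no n_s with s ≠ t is a multiple of n_t. Translating by a_t,
--   w(a_t + x) − c = [n_t ∣ x] + Σ_{s ≠ t} [x ≡ a_s − a_t (mod n_s)] − c,
-- so the indicator of n_t ℤ plus a sum of periodic functions, none with a period divisible
-- by n_t, vanishes mod m everywhere. Such a relation forces m ∣ 1, and then m n_t = n_t
-- divides the lcm. Induct on the prime factors of n = p n′: with T the product of the periods
-- prime to p, the difference F(p y) − F(p y + T) kills every component of period prime to p,
-- turns [p n′ ∣ x] into [n′ ∣ y] (as p ∤ T), and turns a component of period p d′ into one of
-- period d′, where n′ ∤ d′. For n = 1 all components vanish and the relation at 0 reads m ∣ 1.
module Submission where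

open import Defs
open import Data.Nat using (ℕ; _>_; _≥_; _*_)
open import Data.Nat.Divisibility using (_∣_)
open import Data.Integer using (ℤ; +_)
open import Data.Fin using (Fin)
open import Data.Product using (Σ; _×_)
open import Relation.Nullary using (¬_)
open import Relation.Binary.PropositionalEquality using (_≢_)

open import Data.Bool using (true; false; if_then_else_)
open import Data.Fin using (zero; suc; punchIn)
open import Data.Fin.Properties using (any?; _≟_; punchInᵢ≢i)
open import Data.Integer as ℤ using (_+_; _-_; -_; 0ℤ; 1ℤ; ∣_∣)
open import Data.Integer.Properties
  using (+-0-commutativeMonoid; +-assoc; +-identityˡ; +-identityʳ; +-inverseʳ; *-distribˡ-+; pos-+; pos-*; abs-*)
open import Data.Integer.Divisibility.Signed
  using (∣ᵤ⇒∣; ∣⇒∣ᵤ; ∣-refl; ∣m∣n⇒∣m+n; ∣m+n∣n⇒∣m; ∣m+n∣m⇒∣n; ∣m∣n⇒∣m-n; ∣m⇒∣m*n)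
  renaming (_∣_ to _∣ℤ_)
open import Data.Integer.Tactic.RingSolver using (solve-∀)
open import Data.List using ([]; _∷_; tabulate; filter; length; foldr)
open import Data.List.Membership.Propositional using (_∈_)
open import Data.List.Membership.Propositional.Properties using (∈-filter⁺; ∈-tabulate⁺; ∈-allFin)
open import Data.List.Relation.Unary.All using (All; []; _∷_)
open import Data.List.Relation.Unary.All.Properties using (all-filter)
open import Data.List.Relation.Unary.Any using (here; there)
open import Data.Nat as ℕ using (suc; NonZero; >-nonZero)
open import Data.Nat.Divisibility
  using (divides; _∣?_; ∣-trans; ∣1⇒≡1; 1∣_; m∣m*n; *-monoʳ-∣; *-cancelˡ-∣; m∣n/o⇒o*m∣n)
open import Data.Nat.DivMod using (_/_; m*[n/m]≡n)
open import Data.Nat.LCM using (lcm; m∣lcm[m,n]; n∣lcm[m,n])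
open import Data.Nat.ListAction using (product)
open import Data.Nat.ListAction.Properties using (∈⇒∣product)
open import Data.Nat.Primality using (Prime; euclidsLemma; prime⇒nonZero; ¬prime[1])
open import Data.Nat.Primality.Factorisation using (PrimeFactorisation; factorise)
open import Data.Nat.Properties using (*-identityˡ)
open import Data.Product using (_,_)
open import Data.Sum using ([_,_]′)
open import Function using (_∘_; id; const; _⇔_; mk⇔)
open import Relation.Nullary using (Dec; yes; no; does; ¬?; contradiction)
open import Relation.Nullary.Decidable using (dec-false; does-⇔; _×-dec_)
open import Relation.Unary using (Decidable)
open import Relation.Binary.PropositionalEquality
  using (_≡_; refl; sym; trans; cong; cong₂; subst; _≗_; module ≡-Reasoning)
open ≡-Reasoning

open import Algebra.Properties.CommutativeMonoid.Sum +-0-commutativeMonoid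
  using (sum; sum-syntax; sum-remove; sum-cong-≗; sum-replicate-zero)

private variable
  A B : Set
  d e m n p r : ℕ
  f g : ℤ → ℤ

𝟙 : Dec A → ℤ
𝟙 a? = if does a? then 1ℤ else 0ℤ

𝟙-⇔ : (a? : Dec A) (b? : Dec B) → A ⇔ B → 𝟙 a? ≡ 𝟙 b?
𝟙-⇔ a? b? A⇔B = cong (λ b → if b then 1ℤ else 0ℤ) (does-⇔ A⇔B a? b?)

𝟙-no : (a? : Dec A) → ¬ A → 𝟙 a? ≡ 0ℤ
𝟙-no a? ¬a rewrite dec-false a? ¬a = refl

length-filter-tabulate : {P : A → Set} (P? : Decidable P) {k : ℕ} (g : Fin k → A) →
  + length (filter P? (tabulate g)) ≡ ∑[ i < k ] 𝟙 (P? (g i))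
length-filter-tabulate P? {ℕ.zero} g = refl
length-filter-tabulate P? {suc k} g with does (P? (g zero))
... | true  = cong (_+_ 1ℤ) (length-filter-tabulate P? (g ∘ suc))
... | false = trans (length-filter-tabulate P? (g ∘ suc)) (sym (+-identityˡ _))

∑-distrib-minus : (u v : Fin r → ℤ) → ∑[ i < r ] (u i - v i) ≡ ∑[ i < r ] u i - ∑[ i < r ] v i
∑-distrib-minus {ℕ.zero} u v = refl
∑-distrib-minus {suc r} u v =
  trans (cong (_+_ (u zero - v zero)) (∑-distrib-minus (u ∘ suc) (v ∘ suc)))
        (interchange (u zero) (v zero) (sum (u ∘ suc)) (sum (v ∘ suc)))
  where
  interchange : ∀ a b c d → (a - b) + (c - d) ≡ (a + c) - (b + d)
  interchange = solve-∀

Periodic : ℕ → (ℤ → ℤ) → Set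
Periodic d f = ∀ x → f (x + + d) ≡ f x

periodic-* : Periodic d f → ∀ q → Periodic (q * d) f
periodic-* {f = f} per ℕ.zero x = cong f (+-identityʳ x)
periodic-* {d} {f} per (suc q) x = begin
  f (x + + (d ℕ.+ q * d))   ≡⟨ cong (λ z → f (x + z)) (pos-+ d (q * d)) ⟩
  f (x + (+ d + + (q * d))) ≡⟨ cong f (+-assoc x (+ d) _) ⟨
  f (x + + d + + (q * d))   ≡⟨ periodic-* per q (x + + d) ⟩
  f (x + + d)               ≡⟨ per x ⟩
  f x                       ∎

periodic-∣ : Periodic d f → d ∣ e → Periodic e f
periodic-∣ per (divides q refl) = periodic-* per q

≗0⇒periodic : f ≗ const 0ℤ → Periodic d f
≗0⇒periodic f≗0 x = trans (f≗0 _) (sym (f≗0 x))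

periodic-shift : Periodic d f → ∀ c → Periodic d (λ x → f (x + c))
periodic-shift {d} {f} per c x = trans (cong f (swap x (+ d) c)) (per (x + c))
  where
  swap : ∀ x d c → x + d + c ≡ x + c + d
  swap = solve-∀

periodic-sub : Periodic d f → Periodic d g → Periodic d (λ x → f x - g x)
periodic-sub perf perg x = cong₂ _-_ (perf x) (perg x)

periodic-dilate : ∀ p .{{_ : NonZero p}} → Periodic d f → p ∣ d →
  Periodic (d / p) (λ y → f (+ p ℤ.* y))
periodic-dilate {d} {f} p per p∣d y = begin
  f (+ p ℤ.* (y + + (d / p)))         ≡⟨ cong f (*-distribˡ-+ (+ p) y _) ⟩
  f (+ p ℤ.* y + + p ℤ.* + (d / p))   ≡⟨ cong (λ z → f (+ p ℤ.* y + z)) p*[d/p]≡d ⟩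
  f (+ p ℤ.* y + + d)                 ≡⟨ per _ ⟩
  f (+ p ℤ.* y)                       ∎
  where
  p*[d/p]≡d : + p ℤ.* + (d / p) ≡ + d
  p*[d/p]≡d = trans (sym (pos-* p (d / p))) (cong +_ (m*[n/m]≡n p∣d))

𝟙[_∣_] : ℕ → ℤ → ℤ
𝟙[ n ∣ x ] = 𝟙 (n ∣? ∣ x ∣)

𝟙[∣]-periodic : ∀ n → Periodic n 𝟙[ n ∣_]
𝟙[∣]-periodic n x = 𝟙-⇔ (n ∣? ∣ x + + n ∣) (n ∣? ∣ x ∣) (mk⇔
  (λ n∣x+n → ∣⇒∣ᵤ (∣m+n∣n⇒∣m {+ n} {x} {+ n} (∣ᵤ⇒∣ {+ n} {x + + n} n∣x+n) ∣-refl))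
  (λ n∣x → ∣⇒∣ᵤ (∣m∣n⇒∣m+n {+ n} {x} {+ n} (∣ᵤ⇒∣ {+ n} {x} n∣x) ∣-refl)))

𝟙[∣]-dilate : ∀ p n .{{_ : NonZero p}} y → 𝟙[ p * n ∣ + p ℤ.* y ] ≡ 𝟙[ n ∣ y ]
𝟙[∣]-dilate p n y = 𝟙-⇔ (p * n ∣? ∣ + p ℤ.* y ∣) (n ∣? ∣ y ∣) (mk⇔
  (λ pn∣py → *-cancelˡ-∣ p (subst (p * n ∣_) (abs-* (+ p) y) pn∣py))
  (λ n∣y → subst (p * n ∣_) (sym (abs-* (+ p) y)) (*-monoʳ-∣ p n∣y)))

𝟙[∣]-offset : ∀ p n {T} → ¬ p ∣ T → ∀ y → 𝟙[ p * n ∣ + p ℤ.* y + + T ] ≡ 0ℤ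
𝟙[∣]-offset p n {T} p∤T y = 𝟙-no (p * n ∣? ∣ + p ℤ.* y + + T ∣) λ pn∣py+T →
  p∤T (∣⇒∣ᵤ (∣m+n∣m⇒∣n (∣ᵤ⇒∣ {+ p} {+ p ℤ.* y + + T} (∣-trans (m∣m*n n) pn∣py+T))
                       (∣m⇒∣m*n y ∣-refl)))

residue-periodic : ∀ n b c → Periodic n (λ x → 𝟙[ n ∣ (b + x) - c ])
residue-periodic n b c x =
  trans (cong 𝟙[ n ∣_] (regroup b x (+ n) c)) (𝟙[∣]-periodic n ((b + x) - c))
  where
  regroup : ∀ b x d c → (b + (x + d)) - c ≡ ((b + x) - c) + d
  regroup = solve-∀

record PeriodicFamily (n r : ℕ) : Set where
  field
    period      : Fin r → ℕ
    component   : Fin r → ℤ → ℤ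
    periodic    : ∀ i → Periodic (period i) (component i)
    -- Zero components are allowed (rather than forbidding n ∣ period i outright) so that the
    -- descent can keep the index set fixed.
    n∣period⇒≗0 : ∀ i → n ∣ period i → component i ≗ const 0ℤ

  total : ℤ → ℤ
  total x = ∑[ i < r ] component i x

open PeriodicFamily using (total)

VanishesMod : ℕ → (ℤ → ℤ) → Set
VanishesMod m f = ∀ x → + m ∣ℤ f x

prime∤product : ∀ {es} → Prime p → All (λ e → ¬ p ∣ e) es → ¬ p ∣ product es
prime∤product p-prime []            p∣1   = ¬prime[1] (subst Prime (∣1⇒≡1 p∣1) p-prime)
prime∤product p-prime (p∤e ∷ p∤es) p∣Πes =
  [ p∤e , prime∤product p-prime p∤es ]′ (euclidsLemma _ _ p-prime p∣Πes)

module Descent {p n r : ℕ} (p-prime : Prime p) (F : PeriodicFamily (p * n) r) where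
  open PeriodicFamily F hiding (total)

  private instance
    p≢0 : NonZero p
    p≢0 = prime⇒nonZero p-prime

  T : ℕ
  T = product (filter (λ e → ¬? (p ∣? e)) (tabulate period))

  p∤T : ¬ p ∣ T
  p∤T = prime∤product p-prime (all-filter (λ e → ¬? (p ∣? e)) (tabulate period))

  p∤period⇒period∣T : ∀ i → ¬ p ∣ period i → period i ∣ T
  p∤period⇒period∣T i p∤d = ∈⇒∣product (∈-filter⁺ (λ e → ¬? (p ∣? e)) (∈-tabulate⁺ i) p∤d)

  Δ : (ℤ → ℤ) → ℤ → ℤ
  Δ f y = f (+ p ℤ.* y) - f (+ p ℤ.* y + + T)

  Δ-periodic : Periodic d f → p ∣ d → Periodic (d / p) (Δ f)
  Δ-periodic per p∣d =
    periodic-sub (periodic-dilate p per p∣d) (periodic-dilate p (periodic-shift per (+ T)) p∣d)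

  period∣T⇒Δ≗0 : Periodic d f → d ∣ T → Δ f ≗ const 0ℤ
  period∣T⇒Δ≗0 {f = f} per d∣T y =
    trans (cong (_-_ (f (+ p ℤ.* y))) (periodic-∣ per d∣T (+ p ℤ.* y)))
          (+-inverseʳ (f (+ p ℤ.* y)))

  ≗0⇒Δ≗0 : f ≗ const 0ℤ → Δ f ≗ const 0ℤ
  ≗0⇒Δ≗0 f≗0 y = cong₂ _-_ (f≗0 _) (f≗0 _)

  -- When p ∤ period i the new component is identically 0, so the junk period period i / p is
  -- harmless.
  family : PeriodicFamily n r
  family = record
    { period      = λ i → period i / p
    ; component   = Δ ∘ component
    ; periodic    = periodic′
    ; n∣period⇒≗0 = n∣period⇒≗0′
    }
    where
    periodic′ : ∀ i → Periodic (period i / p) (Δ (component i))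
    periodic′ i with p ∣? period i
    ... | yes p∣d = Δ-periodic (periodic i) p∣d
    ... | no  p∤d = ≗0⇒periodic (period∣T⇒Δ≗0 (periodic i) (p∤period⇒period∣T i p∤d))

    n∣period⇒≗0′ : ∀ i → n ∣ period i / p → Δ (component i) ≗ const 0ℤ
    n∣period⇒≗0′ i n∣d/p with p ∣? period i
    ... | yes p∣d = ≗0⇒Δ≗0 (n∣period⇒≗0 i (m∣n/o⇒o*m∣n p∣d n∣d/p))
    ... | no  p∤d = period∣T⇒Δ≗0 (periodic i) (p∤period⇒period∣T i p∤d)

  indicator+total≡Δ : ∀ y → 𝟙[ n ∣ y ] + total family y ≡ Δ (λ x → 𝟙[ p * n ∣ x ] + total F x) y
  indicator+total≡Δ y = begin
    𝟙[ n ∣ y ] + ∑[ i < r ] (component i py - component i py+T)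
      ≡⟨ cong (_+_ 𝟙[ n ∣ y ]) (∑-distrib-minus (λ i → component i py) (λ i → component i py+T)) ⟩
    𝟙[ n ∣ y ] + (total F py - total F py+T)
      ≡⟨ regroup 𝟙[ n ∣ y ] (total F py) (total F py+T) ⟩
    (𝟙[ n ∣ y ] + total F py) - (0ℤ + total F py+T)
      ≡⟨ cong₂ (λ u v → (u + total F py) - (v + total F py+T))
               (𝟙[∣]-dilate p n y) (𝟙[∣]-offset p n p∤T y) ⟨
    (𝟙[ p * n ∣ py ] + total F py) - (𝟙[ p * n ∣ py+T ] + total F py+T)
      ∎
    where
    py py+T : ℤ
    py   = + p ℤ.* y
    py+T = + p ℤ.* y + + T
    regroup : ∀ a u v → a + (u - v) ≡ (a + u) - (0ℤ + v)
    regroup = solve-∀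

  Δ-vanishesMod : VanishesMod m f → VanishesMod m (Δ f)
  Δ-vanishesMod f≡0 y = ∣m∣n⇒∣m-n (f≡0 _) (f≡0 _)

𝟙[∣]+periodic-vanishesMod⇒∣1′ : ∀ ps → All Prime ps → n ≡ product ps →
  (F : PeriodicFamily n r) → VanishesMod m (λ x → 𝟙[ n ∣ x ] + total F x) → m ∣ 1
𝟙[∣]+periodic-vanishesMod⇒∣1′ {r = r} {m = m} [] [] refl F vanishes =
  ∣⇒∣ᵤ (subst (+ m ∣ℤ_) (cong (_+_ 1ℤ) total≡0) (vanishes 0ℤ))
  where
  open PeriodicFamily F hiding (total)
  total≡0 : total F 0ℤ ≡ 0ℤ
  total≡0 = trans (sum-cong-≗ (λ i → n∣period⇒≗0 i (1∣ _) 0ℤ)) (sum-replicate-zero r)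
𝟙[∣]+periodic-vanishesMod⇒∣1′ {m = m} (p ∷ ps) (p-prime ∷ primes) refl F vanishes =
  𝟙[∣]+periodic-vanishesMod⇒∣1′ ps primes refl family
    (λ y → subst (+ m ∣ℤ_) (sym (indicator+total≡Δ y)) (Δ-vanishesMod vanishes y))
  where open Descent p-prime F

𝟙[∣]+periodic-vanishesMod⇒∣1 : .{{_ : NonZero n}} (F : PeriodicFamily n r) →
  VanishesMod m (λ x → 𝟙[ n ∣ x ] + total F x) → m ∣ 1
𝟙[∣]+periodic-vanishesMod⇒∣1 {n} =
  𝟙[∣]+periodic-vanishesMod⇒∣1′ factors factorsPrime isFactorisation
  where open PrimeFactorisation (factorise n)

∣lcmAll : ∀ {k} (n : Fin k → ℕ) s → n s ∣ lcmAll n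
∣lcmAll n s = ∣foldr-lcm (∈-allFin s)
  where
  ∣foldr-lcm : ∀ {xs} → s ∈ xs → n s ∣ foldr (λ s acc → lcm (n s) acc) 1 xs
  ∣foldr-lcm (here refl)           = m∣lcm[m,n] (n s) _
  ∣foldr-lcm {x ∷ _} (there s∈xs) = ∣-trans (∣foldr-lcm s∈xs) (n∣lcm[m,n] (n x) _)

module Covering {k : ℕ} (a : Fin (suc k) → ℤ) (n : Fin (suc k) → ℕ) (c : ℤ) (t : Fin (suc k)) where

  χ : Fin (suc k) → ℤ → ℤ
  χ s y = 𝟙[ n s ∣ y - a s ]

  -- Index 0 carries the constant −c; index suc s carries the class of punchIn t s ≠ t.
  period : Fin (suc k) → ℕ
  period zero    = 1
  period (suc s) = n (punchIn t s)

  component : Fin (suc k) → ℤ → ℤ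
  component zero    _ = - c
  component (suc s) x = χ (punchIn t s) (a t + x)

  family : n t ≢ 1 → (∀ s → s ≢ t → ¬ n t ∣ n s) → PeriodicFamily (n t) (suc k)
  family nt≢1 isolated = record
    { period      = period
    ; component   = component
    ; periodic    = periodic
    ; n∣period⇒≗0 = n∣period⇒≗0
    }
    where
    periodic : ∀ i → Periodic (period i) (component i)
    periodic zero    _ = refl
    periodic (suc s)   = residue-periodic (n (punchIn t s)) (a t) (a (punchIn t s))

    n∣period⇒≗0 : ∀ i → n t ∣ period i → component i ≗ const 0ℤ
    n∣period⇒≗0 zero    nt∣1  = contradiction (∣1⇒≡1 nt∣1) nt≢1
    n∣period⇒≗0 (suc s) nt∣ns = contradiction nt∣ns (isolated (punchIn t s) (punchInᵢ≢i t s))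

  w-c≡𝟙+∑component : ∀ x → + w a n (a t + x) - c ≡ 𝟙[ n t ∣ x ] + ∑[ i < suc k ] component i x
  w-c≡𝟙+∑component x = begin
    + w a n y - c
      ≡⟨ cong (λ u → u - c) (length-filter-tabulate (λ s → congDec y (a s) (n s)) id) ⟩
    ∑[ s < suc k ] χ s y - c
      ≡⟨ cong (λ u → u - c) (sum-remove {i = t} (λ s → χ s y)) ⟩
    (𝟙[ n t ∣ y - a t ] + others) - c
      ≡⟨ cong (λ u → (𝟙[ n t ∣ u ] + others) - c) (cancel (a t) x) ⟩
    (𝟙[ n t ∣ x ] + others) - c
      ≡⟨ regroup 𝟙[ n t ∣ x ] others c ⟩
    𝟙[ n t ∣ x ] + (- c + others)
      ∎
    where
    y others : ℤ
    y = a t + x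
    others = ∑[ s < k ] χ (punchIn t s) y
    cancel : ∀ b x → (b + x) - b ≡ x
    cancel = solve-∀
    regroup : ∀ u v c → (u + v) - c ≡ u + (- c + v)
    regroup = solve-∀

  isolated⇒modulus∣1 : ∀ {m} → (∀ x → (+ w a n x) ≡ c [mod m ]) → .{{_ : NonZero (n t)}} →
    n t ≢ 1 → (∀ s → s ≢ t → ¬ n t ∣ n s) → m ∣ 1
  isolated⇒modulus∣1 {m} w≡c nt≢1 isolated =
    𝟙[∣]+periodic-vanishesMod⇒∣1 (family nt≢1 isolated)
      (λ x → subst (+ m ∣ℤ_) (w-c≡𝟙+∑component x) (∣ᵤ⇒∣ (w≡c (a t + x))))

theorem1p1 : (k : ℕ) → k > 1 → (a : Fin k → ℤ) → (n : Fin k → ℕ) → (∀ s → n s ≥ 1)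
    → (m : ℕ) → m ≥ 1 → (c : ℤ) → (∀ x → (+ w a n x) ≡ c [mod m ])
    → (t : Fin k) → ¬ (m * n t ∣ lcmAll n)
    → Σ (Fin k) (λ s → s ≢ t × n t ∣ n s)
theorem1p1 _ (ℕ.s≤s (ℕ.s≤s ℕ.z≤n)) a n n≥1 m _ c w≡c t m*nt∤lcm
  with any? (λ s → ¬? (s ≟ t) ×-dec (n t ∣? n s))
... | yes found = found
... | no ∄s = contradiction (subst (_∣ lcmAll n) (sym m*nt≡nt) (∣lcmAll n t)) m*nt∤lcm
  where
  isolated : ∀ s → s ≢ t → ¬ n t ∣ n s
  isolated s s≢t nt∣ns = ∄s (s , s≢t , nt∣ns)

  nt≢1 : n t ≢ 1
  nt≢1 nt≡1 = isolated s (punchInᵢ≢i t zero) (subst (_∣ n s) (sym nt≡1) (1∣ n s))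
    where s = punchIn t zero

  instance
    nt≢0 : NonZero (n t)
    nt≢0 = >-nonZero (n≥1 t)

  m≡1 : m ≡ 1
  m≡1 = ∣1⇒≡1 (Covering.isolated⇒modulus∣1 a n c t w≡c nt≢1 isolated)

  m*nt≡nt : m * n t ≡ n t
  m*nt≡nt = trans (cong (_* n t) m≡1) (*-identityˡ (n t))
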